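{- For every $k$-coloured operad $\mathcal{C}$, the enveloping operad $\mathrm{E}(\mathcal{C})$ is isomorphic to the operad $\mathrm{AC}(\mathcal{C}^+)$ of anticoloured syntax trees on $\mathcal{C}^+$.
   Context: All operads are non-symmetric and set-theoretic. A $k$-coloured operad $\mathcal{C}$ is a graded set $\mathcal{C}=\bigsqcup_{n\ge1}\mathcal{C}(n)$ (elements of $\mathcal{C}(n)$ have arity $n$), each $\mathcal{C}(n)$ finite, with maps $\mathrm{Out}$ and $\mathrm{In}_1,\dots,\mathrm{In}_n$ from $\mathcal{C}(n)$ to $[k]$ and partial compositions $x\circ_i y\in\mathcal{C}(|x|+|y|-1)$ defined exactly when $\mathrm{Out}(y)=\mathrm{In}_i(x)$; the output colour of $x\circ_i y$ is $\mathrm{Out}(x)$ and its input colours are those of $x$ with the $i$-th one replaced by those of $y$. These satisfy the usual associativity axioms, and $\mathcal{C}(1)=\{\mathbb{1}_c:c\in[k]\}$ where $\mathbb{1}_c$ has output and input colour $c$ and is a unit. Let $\mathcal{C}^+=\mathcal{C}\setminus\mathcal{C}(1)$. Let $\mathcal{F}$ be the free (uncoloured) operad on the graded set $\mathcal{C}^+$ (colours forgotten). Its elements are planar rooted trees whose internal nodes with $\ell$ children are labelled by elements of $\mathcal{C}^+(\ell)$, and its composition grafts the root of the second tree onto the $i$-th leaf of the first. Let $\mathrm{Cor}(x)$ be the one-node tree labelled $x$. The enveloping operad is $\mathrm{E}(\mathcal{C}):=\mathcal{F}/_{\equiv}$, where $\equiv$ is the smallest operad congruence with $\mathrm{Cor}(x)\circ_i\mathrm{Cor}(y)\equiv\mathrm{Cor}(x\circ_i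 y)$ whenever $x,y\in\mathcal{C}^+$ and $x\circ_i y$ is defined in $\mathcal{C}$. An anticoloured syntax tree on $\mathcal{C}^+$ is such a labelled planar rooted tree in which, whenever an internal node $s$ labelled $y$ is the $i$-th child of an internal node $r$ labelled $x$, one has $\mathrm{In}_i(x)\neq\mathrm{Out}(y)$. The output colour $\mathrm{Out}(T)$ of $T$ is the output colour of its root label. For an internal node labelled $x$ whose $j$-th child is the $i$-th leaf of $T$, set $\mathrm{In}_i(T)=\mathrm{In}_j(x)$. $\mathrm{AC}(\mathcal{C}^+)$ is the set of these trees together with the leaf (a unit $\mathbb{1}$), with the following composition. For anticoloured trees $S,T$ and a leaf $i$ of $S$, let $r$ be the parent of the $i$-th leaf of $S$, that leaf being its $j$-th child, and let $s$ be the root of $T$. If $\mathrm{Out}(T)\neq\mathrm{In}_i(S)$, then $S\circ_i T$ grafts the root of $T$ onto the $i$-th leaf of $S$. Otherwise $S\circ_i T$ is obtained by grafting and then replacing $r$ (label $x$) and $s$ (label $y$) by a single node labelled $x\circ_j y$, whose children are those of $r$ with the $j$-th one replaced by the children of $s$ in order. -}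

module Defs where

open import Data.Nat using (ℕ; zero; suc; _+_; _∸_; _≤_; _<_; _<ᵇ_)
open import Data.Fin using (Fin)
import Data.Fin.Properties as FinP
open import Data.List using (List; []; _∷_; _++_; length; take; drop; replicate)
open import Data.List.Relation.Unary.All using (All)
open import Data.Maybe using (Maybe; just; nothing)
import Data.Maybe.Properties as MaybeP
open import Data.Bool using (if_then_else_)
open import Data.Product using (Σ; _×_; _,_)
open import Function.Bundles using (_↔_)
open import Relation.Binary.PropositionalEquality using (_≡_; _≢_)
open import Relation.Nullary using (yes; no)

_!?_ : ∀ {a} {A : Set a} → List A → ℕ → Maybe A
[] !? i = nothing
(x ∷ xs) !? zero = just x
(x ∷ xs) !? suc i = xs !? i

-- An element x has arity  length (ins x)  ≥ 1, output colour  out x  and input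
-- colours  ins x  (a list, position i = In_{i+1}(x); all positions are 0-based).
-- comp x i y p  is  x ∘_{i+1} y, defined exactly when In_{i+1}(x) = Out(y),
-- which is what  p : ins x !? i ≡ just (out y)  expresses (it also forces i < |x|).
record ColOperad (k : ℕ) : Set₁ where
  field
    Op   : Set
    out  : Op → Fin k
    ins  : Op → List (Fin k)
    comp : (x : Op) (i : ℕ) (y : Op) → ins x !? i ≡ just (out y) → Op
    unit : Fin k → Op
    arity-pos : ∀ x → 1 ≤ length (ins x)
    finite    : ∀ n → Σ ℕ λ m → (Σ Op λ x → length (ins x) ≡ n) ↔ Fin m
    out-comp : ∀ x i y p → out (comp x i y p) ≡ out x
    ins-comp : ∀ x i y p → ins (comp x i y p) ≡ take i (ins x) ++ ins y ++ drop (suc i) (ins x)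
    out-unit  : ∀ c → out (unit c) ≡ c
    ins-unit  : ∀ c → ins (unit c) ≡ c ∷ []
    arity-one : ∀ x → length (ins x) ≡ 1 → Σ (Fin k) λ c → x ≡ unit c
    unit-left  : ∀ c x p → comp (unit c) 0 x p ≡ x
    unit-right : ∀ x i c p → comp x i (unit c) p ≡ x
    assoc-seq : ∀ x i y j z p q p′ q′ →
      comp (comp x i y p) (i + j) z p′ ≡ comp x i (comp y j z q) q′
    assoc-par : ∀ x i y j z → i < j → ∀ p q p′ q′ →
      comp (comp x j z p) i y q ≡ comp (comp x i y p′) (j + length (ins y) ∸ 1) z q′

module Trees {k : ℕ} (C : ColOperad k) where
  open ColOperad C

  data RTree : Set where
    leaf : RTree
    node : Op → List RTree → RTree

  mutual
    leaves : RTree → ℕ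
    leaves leaf = 1
    leaves (node x ts) = leavesL ts

    leavesL : List RTree → ℕ
    leavesL [] = 0
    leavesL (t ∷ ts) = leaves t + leavesL ts

  -- elements of the free operad F on C⁺: every node is labelled by an element of
  -- arity ≥ 2 and has exactly that many children
  data WF : RTree → Set where
    wf-leaf : WF leaf
    wf-node : ∀ {x ts} → 2 ≤ length (ins x) → length ts ≡ length (ins x) →
              All WF ts → WF (node x ts)

  Cor : Op → RTree
  Cor x = node x (replicate (length (ins x)) leaf)

  mutual
    graft : RTree → ℕ → RTree → RTree
    graft leaf zero T = T
    graft leaf (suc i) T = leaf
    graft (node x ts) i T = node x (graftL ts i T)

    graftL : List RTree → ℕ → RTree → List RTree
    graftL [] i T = []
    graftL (t ∷ ts) i T =
      if i <ᵇ leaves t then graft t i T ∷ ts else t ∷ graftL ts (i ∸ leaves t) T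

  data _≈F_ : RTree → RTree → Set where
    ≈-gen   : ∀ x y i p → 2 ≤ length (ins x) → 2 ≤ length (ins y) →
              graft (Cor x) i (Cor y) ≈F Cor (comp x i y p)
    ≈-refl  : ∀ {S} → WF S → S ≈F S
    ≈-sym   : ∀ {S T} → S ≈F T → T ≈F S
    ≈-trans : ∀ {S T U} → S ≈F T → T ≈F U → S ≈F U
    ≈-cong  : ∀ {S S′ T T′} i → WF S → WF S′ → WF T → WF T′ → i < leaves S →
              S ≈F S′ → T ≈F T′ → graft S i T ≈F graft S′ i T′

  data AntiC : RTree → Set where
    ac-leaf : AntiC leaf
    ac-node : ∀ {x ts} → All AntiC ts →
              (∀ j y us → ts !? j ≡ just (node y us) → ins x !? j ≢ just (out y)) →
              AntiC (node x ts)

  -- composition in AC(C⁺).  The target leaf is the child at position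
  -- length pre of a node labelled x whose other children are pre and rest.
  mergeAt : Op → List RTree → List RTree → RTree → RTree
  mergeAt x pre rest leaf = node x (pre ++ leaf ∷ rest)
  mergeAt x pre rest (node y us)
    with MaybeP.≡-dec FinP._≟_ (ins x !? length pre) (just (out y))
  ... | yes p = node (comp x (length pre) y p) (pre ++ us ++ rest)
  ... | no _  = node x (pre ++ node y us ∷ rest)

  mutual
    acComp : RTree → ℕ → RTree → RTree
    acComp leaf zero T = T
    acComp leaf (suc i) T = leaf
    acComp (node x ts) i T = acL x [] ts i T

    acL : Op → List RTree → List RTree → ℕ → RTree → RTree
    acL x pre [] i T = node x pre
    acL x pre (leaf ∷ rest) zero T = mergeAt x pre rest T
    acL x pre (leaf ∷ rest) (suc i) T = acL x (pre ++ leaf ∷ []) rest i T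
    acL x pre (t@(node y us) ∷ rest) i T =
      if i <ᵇ leaves t
      then node x (pre ++ acComp t i T ∷ rest)
      else acL x (pre ++ t ∷ []) rest (i ∸ leaves t) T

-- The map nf normalises a tree of the free operad by contracting, children
-- first, every edge along which the colours match.  Each contraction is an
-- instance of the generating relation Cor x ∘ᵢ Cor y ≈ Cor (x ∘ᵢ y), so T ≈ nf T,
-- and nf fixes anticoloured trees, so it is onto AC(C⁺).  Composition in
-- AC(C⁺) performs exactly one contraction at the grafting point, which makes
-- nf an operad morphism F → AC(C⁺); it identifies the two sides of every
-- generator, hence is constant on ≈-classes.  Thus ≈ is the kernel of nf and
-- nf induces E(C) ≅ AC(C⁺).
module Submission where

open import Defs
open import Data.Nat using (ℕ; zero; suc; _+_; _∸_; _≤_; _<_; _<ᵇ_; z≤n; s≤s; s≤s⁻¹)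
open import Data.Nat.Properties
open import Data.Nat.Tactic.RingSolver using (solve-∀)
open import Data.List using (List; []; _∷_; _++_; length; take; drop; replicate)
open import Data.List.Properties using (++-assoc; ++-identityʳ; length-++; length-take; length-drop; length-replicate)
open import Data.List.Relation.Unary.All using (All; []; _∷_)
open import Data.List.Relation.Unary.All.Properties using (++⁺; replicate⁺)
open import Data.Maybe using (Maybe; just)
import Data.Maybe.Properties as MaybeP
import Data.Fin.Properties as FinP
open import Data.Fin using (Fin)
open import Data.Bool using (true; false; T)
open import Data.Product using (Σ; _×_; _,_; proj₁; proj₂)
open import Data.Sum using (_⊎_; inj₁; inj₂)
open import Data.Empty using (⊥-elim)
open import Data.Unit using (tt)
open import Relation.Binary.PropositionalEquality
open import Relation.Nullary using (Dec; yes; no)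
import Axiom.UniquenessOfIdentityProofs as UIP

module _ {A : Set} where

  !?-++ˡ : ∀ (xs ys : List A) m → m < length xs → (xs ++ ys) !? m ≡ xs !? m
  !?-++ˡ (x ∷ xs) ys zero    _         = refl
  !?-++ˡ (x ∷ xs) ys (suc m) (s≤s m<n) = !?-++ˡ xs ys m m<n

  !?-++ʳ : ∀ (xs ys : List A) m → (xs ++ ys) !? (length xs + m) ≡ ys !? m
  !?-++ʳ []       ys m = refl
  !?-++ʳ (x ∷ xs) ys m = !?-++ʳ xs ys m

  !?-++⁻ : ∀ (xs ys : List A) m {a} → (xs ++ ys) !? m ≡ just a →
           (m < length xs × xs !? m ≡ just a) ⊎ Σ ℕ λ q → m ≡ length xs + q × ys !? q ≡ just a
  !?-++⁻ []       ys m       e = inj₂ (m , refl , e)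
  !?-++⁻ (x ∷ xs) ys zero    e = inj₁ (s≤s z≤n , e)
  !?-++⁻ (x ∷ xs) ys (suc m) e with !?-++⁻ xs ys m e
  ... | inj₁ (m<n , e′)    = inj₁ (s≤s m<n , e′)
  ... | inj₂ (q , eq , e′) = inj₂ (q , cong suc eq , e′)

  !?-take : ∀ j (xs : List A) m → m < j → take j xs !? m ≡ xs !? m
  !?-take (suc j) []       m       _         = refl
  !?-take (suc j) (x ∷ xs) zero    _         = refl
  !?-take (suc j) (x ∷ xs) (suc m) (s≤s m<j) = !?-take j xs m m<j

  !?-drop : ∀ j (xs : List A) m → drop j xs !? m ≡ xs !? (j + m)
  !?-drop zero    xs       m = refl
  !?-drop (suc j) []       m = refl
  !?-drop (suc j) (x ∷ xs) m = !?-drop j xs m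

  !?-just⇒< : ∀ (xs : List A) m {a} → xs !? m ≡ just a → m < length xs
  !?-just⇒< (x ∷ xs) zero    _ = s≤s z≤n
  !?-just⇒< (x ∷ xs) (suc m) e = s≤s (!?-just⇒< xs m e)

  !?-replicate : ∀ n (a : A) m {b} → replicate n a !? m ≡ just b → b ≡ a
  !?-replicate (suc n) a zero    refl = refl
  !?-replicate (suc n) a (suc m) e    = !?-replicate n a m e

  replicate-+ : ∀ m n (a : A) → replicate (m + n) a ≡ replicate m a ++ replicate n a
  replicate-+ zero    n a = refl
  replicate-+ (suc m) n a = cong (a ∷_) (replicate-+ m n a)

  length-take-≤ : ∀ j (xs : List A) → j ≤ length xs → length (take j xs) ≡ j
  length-take-≤ j xs j≤n = trans (length-take j xs) (m≤n⇒m⊓n≡m j≤n)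

<ᵇ≡true⇒< : ∀ {m n} → (m <ᵇ n) ≡ true → m < n
<ᵇ≡true⇒< {m} {n} e = <ᵇ⇒< m n (subst T (sym e) tt)

<ᵇ≡false⇒≥ : ∀ {m n} → (m <ᵇ n) ≡ false → n ≤ m
<ᵇ≡false⇒≥ e = ≮⇒≥ (λ m<n → subst T e (<⇒<ᵇ m<n))

<⇒<ᵇ≡true : ∀ {m n} → m < n → (m <ᵇ n) ≡ true
<⇒<ᵇ≡true {m} {n} m<n with m <ᵇ n | <⇒<ᵇ m<n
... | true | _ = refl

≥⇒<ᵇ≡false : ∀ {m n} → n ≤ m → (m <ᵇ n) ≡ false
≥⇒<ᵇ≡false {m} {n} n≤m with m <ᵇ n in e
... | false = refl
... | true  = ⊥-elim (<⇒≱ (<ᵇ≡true⇒< e) n≤m)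

∸-<-+ : ∀ a i b → a ≤ i → i < a + b → i ∸ a < b
∸-<-+ a i b a≤i i<a+b = subst (i ∸ a <_) (m+n∸m≡n a b) (∸-monoˡ-< i<a+b a≤i)

≡a+suc[c]+r⇒> : ∀ {J a c r} → J ≡ a + suc c + r → a < J
≡a+suc[c]+r⇒> {a = a} {c} {r} refl = ≤-trans (m<m+n a (s≤s z≤n)) (m≤m+n (a + suc c) r)

a+suc[c]+r≡suc[a]+[c+r] : ∀ a c r → a + suc c + r ≡ suc a + (c + r)
a+suc[c]+r≡suc[a]+[c+r] = solve-∀

-- the index a + 1 + c + r read after the entry at a has been replaced by b entries
splice-index : ∀ a b c r → 1 ≤ b → a + (b + (c + r)) ≡ a + suc c + r + b ∸ 1
splice-index a (suc b) c r _ = trans (rearrange a b c r) (cong (_∸ 1) (sym (+-suc (a + suc c + r) b)))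
  where
  rearrange : ∀ a b c r → a + (suc b + (c + r)) ≡ a + suc c + r + b
  rearrange = solve-∀

module NormalForm {k : ℕ} (C : ColOperad k) where
  open ColOperad C
  open Trees C

  arity : Op → ℕ
  arity x = length (ins x)

  infix 4 _≟ᶜ_
  _≟ᶜ_ : (a b : Maybe (Fin k)) → Dec (a ≡ b)
  _≟ᶜ_ = MaybeP.≡-dec FinP._≟_

  colour-irrelevant : ∀ {a b : Maybe (Fin k)} (p q : a ≡ b) → p ≡ q
  colour-irrelevant = UIP.Decidable⇒UIP.≡-irrelevant _≟ᶜ_

  comp-cong : ∀ {x x′ j j′ y y′} → x ≡ x′ → j ≡ j′ → y ≡ y′ → ∀ p p′ →
              comp x j y p ≡ comp x′ j′ y′ p′
  comp-cong {x} {j = j} {y = y} refl refl refl p p′ = cong (comp x j y) (colour-irrelevant p p′)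

  comp-index< : ∀ x j y → ins x !? j ≡ just (out y) → j < arity x
  comp-index< x j y p = !?-just⇒< (ins x) j p

  module _ (x : Op) (j : ℕ) (y : Op) (p : ins x !? j ≡ just (out y)) where

    private
      length-prefix : length (take j (ins x)) ≡ j
      length-prefix = length-take-≤ j (ins x) (<⇒≤ (comp-index< x j y p))

      ins-comp-from : ∀ q → ins (comp x j y p) !? (j + q) ≡ (ins y ++ drop (suc j) (ins x)) !? q
      ins-comp-from q rewrite ins-comp x j y p =
        subst (λ n → (take j (ins x) ++ ins y ++ drop (suc j) (ins x)) !? (n + q)
                     ≡ (ins y ++ drop (suc j) (ins x)) !? q)
              length-prefix (!?-++ʳ (take j (ins x)) _ q)

    ins-comp-< : ∀ m → m < j → ins (comp x j y p) !? m ≡ ins x !? m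
    ins-comp-< m m<j rewrite ins-comp x j y p =
      trans (!?-++ˡ (take j (ins x)) _ m (subst (m <_) (sym length-prefix) m<j))
            (!?-take j (ins x) m m<j)

    ins-comp-inner : ∀ q → q < arity y → ins (comp x j y p) !? (j + q) ≡ ins y !? q
    ins-comp-inner q q<m = trans (ins-comp-from q) (!?-++ˡ (ins y) _ q q<m)

    ins-comp-> : ∀ r → ins (comp x j y p) !? (j + (arity y + r)) ≡ ins x !? (suc j + r)
    ins-comp-> r = trans (ins-comp-from (arity y + r))
                         (trans (!?-++ʳ (ins y) _ r) (!?-drop (suc j) (ins x) r))

    arity-comp : arity (comp x j y p) + 1 ≡ arity x + arity y
    arity-comp rewrite ins-comp x j y p
                     | length-++ (take j (ins x)) {ins y ++ drop (suc j) (ins x)}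
                     | length-++ (ins y) {drop (suc j) (ins x)}
                     | length-drop (suc j) (ins x) | length-prefix
      = split (arity x) (comp-index< x j y p)
      where
      split : ∀ a → suc j ≤ a → j + (arity y + (a ∸ suc j)) + 1 ≡ a + arity y
      split a j<a with a ∸ suc j | m∸n+n≡m j<a
      ... | d | refl = rearrange j (arity y) d
        where
        rearrange : ∀ j b d → j + (b + d) + 1 ≡ d + suc j + b
        rearrange = solve-∀

    arity-comp-split : ∀ a c → a + suc c ≡ arity x → a + arity y + c ≡ arity (comp x j y p)
    arity-comp-split a c e = suc-injective (begin
      suc (a + arity y + c)  ≡⟨ rearrange a (arity y) c ⟩
      a + suc c + arity y    ≡⟨ cong (_+ arity y) e ⟩
      arity x + arity y      ≡⟨ sym arity-comp ⟩
      arity (comp x j y p) + 1 ≡⟨ +-comm _ 1 ⟩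
      suc (arity (comp x j y p)) ∎)
      where
      open ≡-Reasoning
      rearrange : ∀ a b c → suc (a + b + c) ≡ a + suc c + b
      rearrange = solve-∀

    arity-comp-≥2 : 2 ≤ arity x → 2 ≤ arity y → 2 ≤ arity (comp x j y p)
    arity-comp-≥2 2≤x 2≤y =
      ≤-trans (n≤1+n 2) (s≤s⁻¹ (subst (4 ≤_) (trans (sym arity-comp) (+-comm _ 1)) (+-mono-≤ 2≤x 2≤y)))

  -- Normal forms

  length-snoc : ∀ (xs : List RTree) c → length (xs ++ c ∷ []) ≡ suc (length xs)
  length-snoc xs c = trans (length-++ xs) (+-comm (length xs) 1)

  length-snoc-+ : ∀ (xs : List RTree) c (ys : List RTree) →
                  length (xs ++ c ∷ []) + length ys ≡ length xs + suc (length ys)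
  length-snoc-+ xs c ys rewrite length-++ xs {c ∷ []} = +-assoc (length xs) 1 (length ys)

  leavesL-++ : ∀ xs ys → leavesL (xs ++ ys) ≡ leavesL xs + leavesL ys
  leavesL-++ []       ys = refl
  leavesL-++ (x ∷ xs) ys rewrite leavesL-++ xs ys = sym (+-assoc (leaves x) _ _)

  leavesL-snoc : ∀ pre w → leavesL (pre ++ w ∷ []) ≡ leavesL pre + leaves w
  leavesL-snoc pre w = trans (leavesL-++ pre _) (cong (leavesL pre +_) (+-identityʳ _))

  leavesL-replicate : ∀ n → leavesL (replicate n leaf) ≡ n
  leavesL-replicate zero    = refl
  leavesL-replicate (suc n) = cong suc (leavesL-replicate n)

  -- A pair (x , pre) stands for a node labelled x whose children are, so far, pre.
  absorb : Op → List RTree → RTree → Op × List RTree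
  absorb x pre leaf = x , pre ++ leaf ∷ []
  absorb x pre (node y us) with ins x !? length pre ≟ᶜ just (out y)
  ... | yes p = comp x (length pre) y p , pre ++ us
  ... | no _  = x , pre ++ node y us ∷ []

  absorbAll : Op → List RTree → List RTree → Op × List RTree
  absorbAll x pre []       = x , pre
  absorbAll x pre (c ∷ cs) = absorbAll (proj₁ (absorb x pre c)) (proj₂ (absorb x pre c)) cs

  close : Op × List RTree → RTree
  close q = node (proj₁ q) (proj₂ q)

  closeWith : Op × List RTree → List RTree → RTree
  closeWith q rest = node (proj₁ q) (proj₂ q ++ rest)

  mutual
    nf : RTree → RTree
    nf leaf        = leaf
    nf (node x ts) = close (absorbAll x [] (nfs ts))

    nfs : List RTree → List RTree
    nfs []       = []
    nfs (t ∷ ts) = nf t ∷ nfs ts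

  length-nfs : ∀ ts → length (nfs ts) ≡ length ts
  length-nfs []       = refl
  length-nfs (t ∷ ts) = cong suc (length-nfs ts)

  mergeAt≡absorb : ∀ x pre rest c → mergeAt x pre rest c ≡ closeWith (absorb x pre c) rest
  mergeAt≡absorb x pre rest leaf = cong (node x) (sym (++-assoc pre (leaf ∷ []) rest))
  mergeAt≡absorb x pre rest (node y us) with ins x !? length pre ≟ᶜ just (out y)
  ... | yes p = cong (node _) (sym (++-assoc pre us rest))
  ... | no _  = cong (node x) (sym (++-assoc pre _ rest))

  leavesL-absorb : ∀ x pre c → leavesL (proj₂ (absorb x pre c)) ≡ leavesL pre + leaves c
  leavesL-absorb x pre leaf = leavesL-snoc pre leaf
  leavesL-absorb x pre (node y us) with ins x !? length pre ≟ᶜ just (out y)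
  ... | yes p = leavesL-++ pre us
  ... | no _  = leavesL-snoc pre (node y us)

  leavesL-absorbAll : ∀ x pre cs → leavesL (proj₂ (absorbAll x pre cs)) ≡ leavesL pre + leavesL cs
  leavesL-absorbAll x pre []       = sym (+-identityʳ _)
  leavesL-absorbAll x pre (c ∷ cs) = begin
    leavesL (proj₂ (absorbAll _ _ cs))                     ≡⟨ leavesL-absorbAll _ _ cs ⟩
    leavesL (proj₂ (absorb x pre c)) + leavesL cs          ≡⟨ cong (_+ leavesL cs) (leavesL-absorb x pre c) ⟩
    leavesL pre + leaves c + leavesL cs                    ≡⟨ +-assoc (leavesL pre) (leaves c) (leavesL cs) ⟩
    leavesL pre + leavesL (c ∷ cs)                         ∎
    where open ≡-Reasoning

  mutual
    leaves-nf : ∀ t → leaves (nf t) ≡ leaves t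
    leaves-nf leaf        = refl
    leaves-nf (node x ts) = trans (leavesL-absorbAll x [] (nfs ts)) (leavesL-nfs ts)

    leavesL-nfs : ∀ ts → leavesL (nfs ts) ≡ leavesL ts
    leavesL-nfs []       = refl
    leavesL-nfs (t ∷ ts) = cong₂ _+_ (leaves-nf t) (leavesL-nfs ts)

  absorb-WF : ∀ x pre c (rest : List RTree) → 2 ≤ arity x → All WF pre → WF c →
              length pre + suc (length rest) ≡ arity x →
              let (x′ , pre′) = absorb x pre c in
              2 ≤ arity x′ × All WF pre′ × length pre′ + length rest ≡ arity x′
  absorb-WF x pre leaf rest 2≤x wpre wc e = 2≤x , ++⁺ wpre (wc ∷ []) , trans (length-snoc-+ pre leaf rest) e
  absorb-WF x pre (node y us) rest 2≤x wpre wc@(wf-node 2≤y eus wus) e with ins x !? length pre ≟ᶜ just (out y)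
  ... | no _  = 2≤x , ++⁺ wpre (wc ∷ []) , trans (length-snoc-+ pre _ rest) e
  ... | yes p = arity-comp-≥2 x (length pre) y p 2≤x 2≤y , ++⁺ wpre wus ,
                trans (cong (_+ length rest) (trans (length-++ pre) (cong (length pre +_) eus)))
                      (arity-comp-split x (length pre) y p (length pre) (length rest) e)

  absorbAll-WF : ∀ x pre cs → 2 ≤ arity x → All WF pre → All WF cs →
                 length pre + length cs ≡ arity x → WF (close (absorbAll x pre cs))
  absorbAll-WF x pre []       2≤x wpre _           e = wf-node 2≤x (trans (sym (+-identityʳ _)) e) wpre
  absorbAll-WF x pre (c ∷ cs) 2≤x wpre (wc ∷ wcs) e with absorb-WF x pre c cs 2≤x wpre wc e
  ... | 2≤x′ , wpre′ , e′ = absorbAll-WF _ _ cs 2≤x′ wpre′ wcs e′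

  mutual
    nf-WF : ∀ t → WF t → WF (nf t)
    nf-WF leaf        _                  = wf-leaf
    nf-WF (node x ts) (wf-node 2≤x e wts) =
      absorbAll-WF x [] (nfs ts) 2≤x [] (nfs-WF ts wts) (trans (length-nfs ts) e)

    nfs-WF : ∀ ts → All WF ts → All WF (nfs ts)
    nfs-WF []       []         = []
    nfs-WF (t ∷ ts) (wt ∷ wts) = nf-WF t wt ∷ nfs-WF ts wts

  CompatibleFrom : Op → ℕ → List RTree → Set
  CompatibleFrom x n rest = ∀ j y us → rest !? j ≡ just (node y us) → ins x !? (n + j) ≢ just (out y)

  Compatible : Op → List RTree → Set
  Compatible x = CompatibleFrom x 0

  compatible-snoc : ∀ x pre c → Compatible x pre →
                    (∀ y us → c ≡ node y us → ins x !? length pre ≢ just (out y)) →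
                    Compatible x (pre ++ c ∷ [])
  compatible-snoc x pre c cpre cc j y us e with !?-++⁻ pre (c ∷ []) j e
  ... | inj₁ (j<n , e′)         = cpre j y us (trans (sym (!?-++ˡ pre _ j j<n)) e)
  ... | inj₂ (zero , refl , e′) =
    λ h → cc y us (MaybeP.just-injective e′) (trans (cong (ins x !?_) (sym (+-identityʳ _))) h)

  compatible-comp : ∀ x pre y us p → Compatible x pre → AntiC (node y us) → length us ≡ arity y →
                    Compatible (comp x (length pre) y p) (pre ++ us)
  compatible-comp x pre y us p cpre (ac-node _ cus) eus j y′ us′ e with !?-++⁻ pre us j e
  ... | inj₁ (j<n , e′)      = λ h → cpre j y′ us′ e′ (trans (sym (ins-comp-< x (length pre) y p j j<n)) h)
  ... | inj₂ (q , refl , e′) =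
    λ h → cus q y′ us′ e′
            (trans (sym (ins-comp-inner x (length pre) y p q (subst (q <_) eus (!?-just⇒< us q e′)))) h)

  absorb-AntiC : ∀ x pre c → Compatible x pre → All AntiC pre → AntiC c → WF c →
                 let (x′ , pre′) = absorb x pre c in Compatible x′ pre′ × All AntiC pre′
  absorb-AntiC x pre leaf cpre apre ac wc = compatible-snoc x pre leaf cpre (λ y us ()) , ++⁺ apre (ac ∷ [])
  absorb-AntiC x pre (node y us) cpre apre ac@(ac-node aus _) (wf-node _ eus _)
    with ins x !? length pre ≟ᶜ just (out y)
  ... | no ¬p = compatible-snoc x pre _ cpre (λ { y′ us′ refl → ¬p }) , ++⁺ apre (ac ∷ [])
  ... | yes p = compatible-comp x pre y us p cpre ac eus , ++⁺ apre aus

  absorbAll-AntiC : ∀ x pre cs → Compatible x pre → All AntiC pre → All AntiC cs → All WF cs →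
                    AntiC (close (absorbAll x pre cs))
  absorbAll-AntiC x pre []       cpre apre _          _          = ac-node apre cpre
  absorbAll-AntiC x pre (c ∷ cs) cpre apre (ac ∷ acs) (wc ∷ wcs) with absorb-AntiC x pre c cpre apre ac wc
  ... | cpre′ , apre′ = absorbAll-AntiC _ _ cs cpre′ apre′ acs wcs

  mutual
    nf-AntiC : ∀ t → WF t → AntiC (nf t)
    nf-AntiC leaf        _                = ac-leaf
    nf-AntiC (node x ts) (wf-node _ _ wts) =
      absorbAll-AntiC x [] (nfs ts) (λ j y us ()) [] (nfs-AntiC ts wts) (nfs-WF ts wts)

    nfs-AntiC : ∀ ts → All WF ts → All AntiC (nfs ts)
    nfs-AntiC []       []         = []
    nfs-AntiC (t ∷ ts) (wt ∷ wts) = nf-AntiC t wt ∷ nfs-AntiC ts wts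

  compatibleFrom-tail : ∀ {x n c rest} → CompatibleFrom x n (c ∷ rest) → CompatibleFrom x (suc n) rest
  compatibleFrom-tail {x} {n} compat j y us e =
    subst (λ m → ins x !? m ≢ just (out y)) (+-suc n j) (compat (suc j) y us e)

  compatible-snoc-tail : ∀ {x} pre c {rest} → CompatibleFrom x (length pre) (c ∷ rest) →
                         CompatibleFrom x (length (pre ++ c ∷ [])) rest
  compatible-snoc-tail {x} pre c {rest} compat =
    subst (λ n → CompatibleFrom x n rest) (sym (length-snoc pre c)) (compatibleFrom-tail compat)

  absorbAll-compatible : ∀ x pre rest → CompatibleFrom x (length pre) rest →
                         absorbAll x pre rest ≡ (x , pre ++ rest)
  absorbAll-compatible x pre [] _ = cong (x ,_) (sym (++-identityʳ pre))
  absorbAll-compatible x pre (leaf ∷ rest) compat =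
    trans (absorbAll-compatible x (pre ++ leaf ∷ []) rest (compatible-snoc-tail pre leaf compat))
          (cong (x ,_) (++-assoc pre _ rest))
  absorbAll-compatible x pre (node y us ∷ rest) compat with ins x !? length pre ≟ᶜ just (out y)
  ... | yes p = ⊥-elim (compat 0 y us refl (trans (cong (ins x !?_) (+-identityʳ _)) p))
  ... | no _  =
    trans (absorbAll-compatible x (pre ++ node y us ∷ []) rest (compatible-snoc-tail pre (node y us) compat))
          (cong (x ,_) (++-assoc pre _ rest))

  mutual
    nf-anticoloured : ∀ A → WF A → AntiC A → nf A ≡ A
    nf-anticoloured leaf        _                  _               = refl
    nf-anticoloured (node x ts) (wf-node _ _ wts) (ac-node acs cts)
      rewrite nfs-anticoloured ts wts acs = cong close (absorbAll-compatible x [] ts cts)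

    nfs-anticoloured : ∀ ts → All WF ts → All AntiC ts → nfs ts ≡ ts
    nfs-anticoloured []       _          _          = refl
    nfs-anticoloured (t ∷ ts) (wt ∷ wts) (at ∷ ats) =
      cong₂ _∷_ (nf-anticoloured t wt at) (nfs-anticoloured ts wts ats)

  node≢leaf : ∀ {y us} → node y us ≢ leaf
  node≢leaf ()

  absorbAll-leaves : ∀ x pre n → absorbAll x pre (replicate n leaf) ≡ (x , pre ++ replicate n leaf)
  absorbAll-leaves x pre n =
    absorbAll-compatible x pre (replicate n leaf) (λ j y us e → ⊥-elim (node≢leaf (!?-replicate n leaf j e)))

  -- Composition in AC(C⁺)

  NodeOfColour : Fin k → RTree → Set
  NodeOfColour c R = Σ Op λ z → Σ (List RTree) λ l → R ≡ node z l × out z ≡ c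

  mergeAt-node : ∀ x pre rest c → NodeOfColour (out x) (mergeAt x pre rest c)
  mergeAt-node x pre rest leaf = x , _ , refl , refl
  mergeAt-node x pre rest (node y us) with ins x !? length pre ≟ᶜ just (out y)
  ... | yes p = _ , _ , refl , out-comp x (length pre) y p
  ... | no _  = x , _ , refl , refl

  acL-node : ∀ x pre ts i T → NodeOfColour (out x) (acL x pre ts i T)
  acL-node x pre []                  i       T = x , pre , refl , refl
  acL-node x pre (leaf ∷ rest)       zero    T = mergeAt-node x pre rest T
  acL-node x pre (leaf ∷ rest)       (suc i) T = acL-node x (pre ++ leaf ∷ []) rest i T
  acL-node x pre (node y us ∷ rest)  i       T with i <ᵇ leavesL us
  ... | true  = x , _ , refl , refl
  ... | false = acL-node x _ rest (i ∸ leavesL us) T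

  acL-descend : ∀ x pre y us rest i T → i < leavesL us →
                acL x pre (node y us ∷ rest) i T ≡ node x (pre ++ acL y [] us i T ∷ rest)
  acL-descend x pre y us rest i T i<n rewrite <⇒<ᵇ≡true i<n = refl

  appendChildren : RTree → List RTree → RTree
  appendChildren leaf       rest = leaf
  appendChildren (node z l) rest = node z (l ++ rest)

  acL-++ : ∀ x pre qs rest i T → i < leavesL qs →
           acL x pre (qs ++ rest) i T ≡ appendChildren (acL x pre qs i T) rest
  acL-++ x pre (leaf ∷ qs) rest zero T _ = begin
    mergeAt x pre (qs ++ rest) T
      ≡⟨ mergeAt≡absorb x pre (qs ++ rest) T ⟩
    closeWith (absorb x pre T) (qs ++ rest)
      ≡⟨ cong (node _) (sym (++-assoc _ qs rest)) ⟩
    appendChildren (closeWith (absorb x pre T) qs) rest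
      ≡⟨ cong (λ R → appendChildren R rest) (sym (mergeAt≡absorb x pre qs T)) ⟩
    appendChildren (mergeAt x pre qs T) rest
      ∎
    where open ≡-Reasoning
  acL-++ x pre (leaf ∷ qs) rest (suc i) T (s≤s i<n) = acL-++ x _ qs rest i T i<n
  acL-++ x pre (node y us ∷ qs) rest i T i<n with i <ᵇ leavesL us in e
  ... | true  = cong (node x) (sym (++-assoc pre _ rest))
  ... | false = acL-++ x _ qs rest (i ∸ leavesL us) T (∸-<-+ _ i _ (<ᵇ≡false⇒≥ e) i<n)

  acL-skip : ∀ x pre qs rest i T →
             acL x pre (qs ++ rest) (leavesL qs + i) T ≡ acL x (pre ++ qs) rest i T
  acL-skip x pre [] rest i T = cong (λ p → acL x p rest i T) (sym (++-identityʳ pre))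
  acL-skip x pre (leaf ∷ qs) rest i T =
    trans (acL-skip x (pre ++ leaf ∷ []) qs rest i T) (cong (λ p → acL x p rest i T) (++-assoc pre _ qs))
  acL-skip x pre (node y us ∷ qs) rest i T
    rewrite +-assoc (leavesL us) (leavesL qs) i
          | ≥⇒<ᵇ≡false {leavesL us + (leavesL qs + i)} {leavesL us} (m≤m+n _ _)
          | m+n∸m≡n (leavesL us) (leavesL qs + i) =
    trans (acL-skip x (pre ++ node y us ∷ []) qs rest i T) (cong (λ p → acL x p rest i T) (++-assoc pre _ qs))

  length-splice-+ : ∀ (pre vs qs : List RTree) w r → length vs ≡ arity w →
                    length (pre ++ vs ++ qs) + r ≡ length pre + (arity w + (length qs + r))
  length-splice-+ pre vs qs w r ev = begin
    length (pre ++ vs ++ qs) + r                ≡⟨ cong (_+ r) (length-++ pre) ⟩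
    length pre + length (vs ++ qs) + r          ≡⟨ cong (λ n → length pre + n + r) (length-++ vs) ⟩
    length pre + (length vs + length qs) + r    ≡⟨ cong (λ n → length pre + (n + length qs) + r) ev ⟩
    length pre + (arity w + length qs) + r      ≡⟨ +-assoc (length pre) _ r ⟩
    length pre + (arity w + length qs + r)      ≡⟨ cong (length pre +_) (+-assoc (arity w) _ r) ⟩
    length pre + (arity w + (length qs + r))    ∎
    where open ≡-Reasoning

  -- acL changes the inputs of the root only at positions it has already passed, so the
  -- colours seen by later children (acL-ins-suffix) and compositions into them
  -- (acL-comp-suffix) are unaffected.
  mergeAt-ins-suffix : ∀ x pre rest T → WF T → ∀ z l → mergeAt x pre rest T ≡ node z l →
                       ∀ r → ins z !? (length l + r) ≡ ins x !? (length pre + suc (length rest) + r)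
  mergeAt-ins-suffix x pre rest leaf _ _ _ refl r = cong (λ n → ins x !? (n + r)) (length-++ pre)
  mergeAt-ins-suffix x pre rest (node w vs) (wf-node _ ev _) z l eq r
    with ins x !? length pre ≟ᶜ just (out w)
  mergeAt-ins-suffix x pre rest (node w vs) (wf-node _ ev _) _ _ refl r | yes p =
    trans (cong (ins (comp x (length pre) w p) !?_) (length-splice-+ pre vs rest w r ev))
      (trans (ins-comp-> x (length pre) w p (length rest + r))
             (cong (ins x !?_) (sym (a+suc[c]+r≡suc[a]+[c+r] (length pre) (length rest) r))))
  mergeAt-ins-suffix x pre rest (node w vs) (wf-node _ ev _) _ _ refl r | no _ =
    cong (λ n → ins x !? (n + r)) (length-++ pre)

  acL-ins-suffix : ∀ x pre qs i T → i < leavesL qs → WF T → ∀ z l → acL x pre qs i T ≡ node z l →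
                   ∀ r → ins z !? (length l + r) ≡ ins x !? (length pre + length qs + r)
  acL-ins-suffix x pre (leaf ∷ qs) zero T _ wT z l eq r = mergeAt-ins-suffix x pre qs T wT z l eq r
  acL-ins-suffix x pre (leaf ∷ qs) (suc i) T (s≤s i<n) wT z l eq r =
    trans (acL-ins-suffix x (pre ++ leaf ∷ []) qs i T i<n wT z l eq r)
          (cong (λ n → ins x !? (n + r)) (length-snoc-+ pre leaf qs))
  acL-ins-suffix x pre (node y us ∷ qs) i T i<n wT z l eq r with i <ᵇ leavesL us in e
  acL-ins-suffix x pre (node y us ∷ qs) i T i<n wT _ _ refl r | true =
    cong (λ n → ins x !? (n + r)) (length-++ pre)
  acL-ins-suffix x pre (node y us ∷ qs) i T i<n wT z l eq r | false =
    trans (acL-ins-suffix x _ qs (i ∸ leavesL us) T (∸-<-+ _ i _ (<ᵇ≡false⇒≥ e) i<n) wT z l eq r)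
          (cong (λ n → ins x !? (n + r)) (length-snoc-+ pre _ qs))

  acL-ins-next : ∀ x pre i T → i < leavesL pre → WF T → ∀ z l → acL x [] pre i T ≡ node z l →
                 ins z !? length l ≡ ins x !? length pre
  acL-ins-next x pre i T i<n wT z l eq =
    trans (cong (ins z !?_) (sym (+-identityʳ _)))
      (trans (acL-ins-suffix x [] pre i T i<n wT z l eq 0) (cong (ins x !?_) (+-identityʳ _)))

  same-index : ∀ {J J′} (pre : List RTree) c (rest : List RTree) r → J ≡ length pre + suc (length rest) + r →
               J′ ≡ length (pre ++ c ∷ rest) + r → J ≡ J′
  same-index pre c rest r eJ eJ′ = trans eJ (trans (cong (_+ r) (sym (length-++ pre))) (sym eJ′))

  mergeAt-comp-suffix : ∀ x pre rest T → WF T → ∀ z l → mergeAt x pre rest T ≡ node z l →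
                        ∀ r J y p J′ p′ → J ≡ length pre + suc (length rest) + r → J′ ≡ length l + r →
                        mergeAt (comp x J y p) pre rest T ≡ node (comp z J′ y p′) l
  mergeAt-comp-suffix x pre rest leaf _ _ _ refl r J y p J′ p′ eJ eJ′ =
    cong (λ o → node o (pre ++ leaf ∷ rest)) (comp-cong refl (same-index pre leaf rest r eJ eJ′) refl p p′)
  mergeAt-comp-suffix x pre rest (node w vs) (wf-node _ ev _) z l eq r J y p J′ p′ eJ eJ′
    with ins x !? length pre ≟ᶜ just (out w) | ins (comp x J y p) !? length pre ≟ᶜ just (out w)
  ... | yes p₀ | no ¬q = ⊥-elim (¬q (trans (ins-comp-< x J y p _ (≡a+suc[c]+r⇒> eJ)) p₀))
  ... | no ¬p₀ | yes q = ⊥-elim (¬p₀ (trans (sym (ins-comp-< x J y p _ (≡a+suc[c]+r⇒> eJ))) q))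
  mergeAt-comp-suffix x pre rest (node w vs) (wf-node _ ev _) _ _ refl r J y p J′ p′ eJ eJ′ | no _ | no _ =
    cong (λ o → node o (pre ++ node w vs ∷ rest))
         (comp-cong refl (same-index pre (node w vs) rest r eJ eJ′) refl p p′)
  mergeAt-comp-suffix x pre rest (node w vs) (wf-node _ ev _) _ _ refl r J y p J′ p′ eJ eJ′ | yes p₀ | yes q =
    cong (λ o → node o (pre ++ vs ++ rest))
      (trans (assoc-par x (length pre) w J y pre<J p q p₀ q′) (comp-cong refl (sym J′≡) refl q′ p′))
    where
    pre<J : length pre < J
    pre<J = ≡a+suc[c]+r⇒> eJ
    J′≡ : J′ ≡ J + arity w ∸ 1
    J′≡ = trans eJ′ (trans (length-splice-+ pre vs rest w r ev)
            (trans (splice-index (length pre) (arity w) (length rest) r (arity-pos w))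
                   (cong (λ n → n + arity w ∸ 1) (sym eJ))))
    q′ : ins (comp x (length pre) w p₀) !? (J + arity w ∸ 1) ≡ just (out y)
    q′ = subst (λ n → ins (comp x (length pre) w p₀) !? n ≡ just (out y)) J′≡ p′

  acL-comp-suffix : ∀ x pre qs i T → i < leavesL qs → WF T → ∀ z l → acL x pre qs i T ≡ node z l →
                    ∀ r J y p J′ p′ → J ≡ length pre + length qs + r → J′ ≡ length l + r →
                    acL (comp x J y p) pre qs i T ≡ node (comp z J′ y p′) l
  acL-comp-suffix x pre (leaf ∷ qs) zero T _ wT z l eq r J y p J′ p′ eJ eJ′ =
    mergeAt-comp-suffix x pre qs T wT z l eq r J y p J′ p′ eJ eJ′
  acL-comp-suffix x pre (leaf ∷ qs) (suc i) T (s≤s i<n) wT z l eq r J y p J′ p′ eJ eJ′ =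
    acL-comp-suffix x (pre ++ leaf ∷ []) qs i T i<n wT z l eq r J y p J′ p′
      (trans eJ (cong (_+ r) (sym (length-snoc-+ pre leaf qs)))) eJ′
  acL-comp-suffix x pre (node y′ us ∷ qs) i T i<n wT z l eq r J y p J′ p′ eJ eJ′ with i <ᵇ leavesL us in e
  acL-comp-suffix x pre (node y′ us ∷ qs) i T i<n wT _ _ refl r J y p J′ p′ eJ eJ′ | true =
    cong (λ o → node o (pre ++ acL y′ [] us i T ∷ qs))
         (comp-cong refl (same-index pre (acL y′ [] us i T) qs r eJ eJ′) refl p p′)
  acL-comp-suffix x pre (node y′ us ∷ qs) i T i<n wT z l eq r J y p J′ p′ eJ eJ′ | false =
    acL-comp-suffix x _ qs (i ∸ leavesL us) T (∸-<-+ _ i _ (<ᵇ≡false⇒≥ e) i<n) wT z l eq r J y p J′ p′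
      (trans eJ (cong (_+ r) (sym (length-snoc-+ pre _ qs)))) eJ′

  acL-absorb : ∀ x pre c i T → i < leavesL pre → WF T → ∀ z l → acL x [] pre i T ≡ node z l →
               let (x′ , pre′) = absorb x pre c in acL x′ [] pre′ i T ≡ close (absorb z l c)
  acL-absorb x pre leaf i T i<n wT z l eq =
    trans (acL-++ x [] pre (leaf ∷ []) i T i<n) (cong (λ R → appendChildren R (leaf ∷ [])) eq)
  acL-absorb x pre (node y us) i T i<n wT z l eq
    with ins x !? length pre ≟ᶜ just (out y) | ins z !? length l ≟ᶜ just (out y)
  ... | yes p | no ¬q = ⊥-elim (¬q (trans (acL-ins-next x pre i T i<n wT z l eq) p))
  ... | no ¬p | yes q = ⊥-elim (¬p (trans (sym (acL-ins-next x pre i T i<n wT z l eq)) q))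
  ... | no _  | no _  =
    trans (acL-++ x [] pre (node y us ∷ []) i T i<n) (cong (λ R → appendChildren R (node y us ∷ [])) eq)
  ... | yes p | yes q =
    trans (acL-++ (comp x (length pre) y p) [] pre us i T i<n)
      (cong (λ R → appendChildren R us)
        (acL-comp-suffix x [] pre i T i<n wT z l eq 0 (length pre) y p (length l) q
           (sym (+-identityʳ _)) (sym (+-identityʳ _))))

  resume : RTree → List RTree → RTree
  resume leaf       cs = leaf
  resume (node z l) cs = close (absorbAll z l cs)

  acL-absorbAll : ∀ x pre cs i T → i < leavesL pre → WF T →
                  let (x′ , pre′) = absorbAll x pre cs in acL x′ [] pre′ i T ≡ resume (acL x [] pre i T) cs
  acL-absorbAll x pre [] i T i<n wT with acL x [] pre i T
  ... | leaf     = refl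
  ... | node _ _ = refl
  acL-absorbAll x pre (c ∷ cs) i T i<n wT with acL-node x [] pre i T
  ... | z , l , eq , _ = begin
    acL _ [] (proj₂ (absorbAll _ _ cs)) i T
      ≡⟨ acL-absorbAll _ _ cs i T i<n′ wT ⟩
    resume (acL _ [] (proj₂ (absorb x pre c)) i T) cs
      ≡⟨ cong (λ R → resume R cs) (acL-absorb x pre c i T i<n wT z l eq) ⟩
    resume (node z l) (c ∷ cs)
      ≡⟨ cong (λ R → resume R (c ∷ cs)) (sym eq) ⟩
    resume (acL x [] pre i T) (c ∷ cs)
      ∎
    where
    open ≡-Reasoning
    i<n′ : i < leavesL (proj₂ (absorb x pre c))
    i<n′ = subst (i <_) (sym (leavesL-absorb x pre c)) (≤-trans i<n (m≤m+n _ _))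

  module _ (x : Op) (j : ℕ) (y : Op) (p : ins x !? j ≡ just (out y))
           (pre : List RTree) (pre-j : length pre ≡ j) where

    ins-comp-++ : ∀ (pre₂ : List RTree) → length pre₂ < arity y →
                  ins (comp x j y p) !? length (pre ++ pre₂) ≡ ins y !? length pre₂
    ins-comp-++ pre₂ pre₂<y =
      trans (cong (ins (comp x j y p) !?_) (trans (length-++ pre) (cong (_+ length pre₂) pre-j)))
            (ins-comp-inner x j y p _ pre₂<y)

    mergeAt-comp-inner : ∀ pre₂ us T → length pre₂ < arity y →
                         ∀ y″ us″ → mergeAt y pre₂ us T ≡ node y″ us″ → ∀ p″ →
                         mergeAt (comp x j y p) (pre ++ pre₂) us T ≡ node (comp x j y″ p″) (pre ++ us″)
    mergeAt-comp-inner pre₂ us leaf _ _ _ refl p″ =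
      cong₂ node (comp-cong refl refl refl p p″) (++-assoc pre pre₂ _)
    mergeAt-comp-inner pre₂ us (node w vs) pre₂<y y″ us″ eq p″
      with ins (comp x j y p) !? length (pre ++ pre₂) ≟ᶜ just (out w) | ins y !? length pre₂ ≟ᶜ just (out w)
    ... | yes q₁ | no ¬q₂ = ⊥-elim (¬q₂ (trans (sym (ins-comp-++ pre₂ pre₂<y)) q₁))
    ... | no ¬q₁ | yes q₂ = ⊥-elim (¬q₁ (trans (ins-comp-++ pre₂ pre₂<y) q₂))
    mergeAt-comp-inner pre₂ us (node w vs) pre₂<y _ _ refl p″ | no _ | no _ =
      cong₂ node (comp-cong refl refl refl p p″) (++-assoc pre pre₂ _)
    mergeAt-comp-inner pre₂ us (node w vs) pre₂<y _ _ refl p″ | yes q₁ | yes q₂ =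
      cong₂ node
        (trans (comp-cong refl index refl q₁ q₁′) (assoc-seq x j y (length pre₂) w p q₂ q₁′ p″))
        (++-assoc pre pre₂ _)
      where
      index : length (pre ++ pre₂) ≡ j + length pre₂
      index = trans (length-++ pre) (cong (_+ length pre₂) pre-j)
      q₁′ : ins (comp x j y p) !? (j + length pre₂) ≡ just (out w)
      q₁′ = trans (cong (ins (comp x j y p) !?_) (sym index)) q₁

    acL-comp-inner : ∀ pre₂ us i T → length pre₂ + length us ≤ arity y → i < leavesL us →
                     ∀ y″ us″ → acL y pre₂ us i T ≡ node y″ us″ → ∀ p″ →
                     acL (comp x j y p) (pre ++ pre₂) us i T ≡ node (comp x j y″ p″) (pre ++ us″)
    acL-comp-inner pre₂ (leaf ∷ us) zero T fits _ y″ us″ eq p″ =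
      mergeAt-comp-inner pre₂ us T (m+n≤o⇒m≤o (suc (length pre₂)) (subst (_≤ arity y) (+-suc _ _) fits))
        y″ us″ eq p″
    acL-comp-inner pre₂ (leaf ∷ us) (suc i) T fits (s≤s i<n) y″ us″ eq p″ =
      trans (cong (λ P → acL (comp x j y p) P us i T) (++-assoc pre pre₂ (leaf ∷ [])))
        (acL-comp-inner (pre₂ ++ leaf ∷ []) us i T (subst (_≤ arity y) (sym (length-snoc-+ pre₂ leaf us)) fits)
           i<n y″ us″ eq p″)
    acL-comp-inner pre₂ (node y′ vs ∷ us) i T fits i<n y″ us″ eq p″ with i <ᵇ leavesL vs in e
    acL-comp-inner pre₂ (node y′ vs ∷ us) i T fits i<n _ _ refl p″ | true =
      cong₂ node (comp-cong refl refl refl p p″) (++-assoc pre pre₂ _)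
    acL-comp-inner pre₂ (node y′ vs ∷ us) i T fits i<n y″ us″ eq p″ | false =
      trans (cong (λ P → acL (comp x j y p) P us (i ∸ leavesL vs) T) (++-assoc pre pre₂ (node y′ vs ∷ [])))
        (acL-comp-inner (pre₂ ++ node y′ vs ∷ []) us (i ∸ leavesL vs) T
           (subst (_≤ arity y) (sym (length-snoc-+ pre₂ _ us)) fits)
           (∸-<-+ _ i _ (<ᵇ≡false⇒≥ e) i<n) y″ us″ eq p″)

  acL-absorb-node : ∀ x pre y′ us′ i T → i < leavesL us′ → length us′ ≡ arity y′ →
                    ∀ y″ us″ → acL y′ [] us′ i T ≡ node y″ us″ → out y″ ≡ out y′ →
                    let (x′ , pre′) = absorb x pre (node y′ us′) in
                    acL x′ [] pre′ (leavesL pre + i) T ≡ close (absorb x pre (node y″ us″))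
  acL-absorb-node x pre y′ us′ i T i<n eus y″ us″ eq same-out
    with ins x !? length pre ≟ᶜ just (out y′) | ins x !? length pre ≟ᶜ just (out y″)
  ... | yes p | no ¬q = ⊥-elim (¬q (trans p (cong just (sym same-out))))
  ... | no ¬p | yes q = ⊥-elim (¬p (trans q (cong just same-out)))
  ... | no _  | no _  = begin
    acL x [] (pre ++ node y′ us′ ∷ []) (leavesL pre + i) T
      ≡⟨ acL-skip x [] pre (node y′ us′ ∷ []) i T ⟩
    acL x pre (node y′ us′ ∷ []) i T
      ≡⟨ acL-descend x pre y′ us′ [] i T i<n ⟩
    node x (pre ++ acL y′ [] us′ i T ∷ [])
      ≡⟨ cong (λ R → node x (pre ++ R ∷ [])) eq ⟩
    node x (pre ++ node y″ us″ ∷ [])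
      ∎
    where open ≡-Reasoning
  ... | yes p | yes q = begin
    acL (comp x (length pre) y′ p) [] (pre ++ us′) (leavesL pre + i) T
      ≡⟨ acL-skip (comp x (length pre) y′ p) [] pre us′ i T ⟩
    acL (comp x (length pre) y′ p) pre us′ i T
      ≡⟨ cong (λ P → acL (comp x (length pre) y′ p) P us′ i T) (sym (++-identityʳ pre)) ⟩
    acL (comp x (length pre) y′ p) (pre ++ []) us′ i T
      ≡⟨ acL-comp-inner x (length pre) y′ p pre refl [] us′ i T (≤-reflexive eus) i<n y″ us″ eq q ⟩
    node (comp x (length pre) y″ q) (pre ++ us″)
      ∎
    where open ≡-Reasoning

  wf-arity : ∀ {x ts} → WF (node x ts) → length ts ≡ arity x
  wf-arity (wf-node _ e _) = e

  leavesL-absorb-nf : ∀ x pre t → leavesL (proj₂ (absorb x pre (nf t))) ≡ leavesL pre + leaves t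
  leavesL-absorb-nf x pre t = trans (leavesL-absorb x pre (nf t)) (cong (leavesL pre +_) (leaves-nf t))

  -- Grafting into a child t of the root changes nf t only below its root, whose output
  -- colour (acL-node), and hence whether the root absorbs it, stays the same.
  mutual
    nf-graft : ∀ S i T → WF S → WF T → i < leaves S → nf (graft S i T) ≡ acComp (nf S) i (nf T)
    nf-graft leaf        zero    T _                  _  _        = refl
    nf-graft leaf        (suc i) T _                  _  (s≤s ())
    nf-graft (node x ts) i       T (wf-node _ _ wts) wT i<n      = absorbAll-graftL x [] ts i T wts wT i<n

    absorbAll-graftL : ∀ x pre ts i T → All WF ts → WF T → i < leavesL ts →
                       let (x′ , pre′) = absorbAll x pre (nfs ts) in
                       close (absorbAll x pre (nfs (graftL ts i T))) ≡ acL x′ [] pre′ (leavesL pre + i) (nf T)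
    absorbAll-graftL x pre (t ∷ ts) i T (wt ∷ wts) wT i<n with i <ᵇ leaves t in e
    ... | true = sym (begin
      acL _ [] (proj₂ (absorbAll x pre (nfs (t ∷ ts)))) (leavesL pre + i) (nf T)
        ≡⟨ acL-absorbAll _ _ (nfs ts) (leavesL pre + i) (nf T) i<n′ (nf-WF T wT) ⟩
      resume (acL _ [] (proj₂ (absorb x pre (nf t))) (leavesL pre + i) (nf T)) (nfs ts)
        ≡⟨ cong (λ R → resume R (nfs ts)) (acL-absorb-nf x pre t i T wt wT i<t) ⟩
      close (absorbAll x pre (nfs (graft t i T ∷ ts)))
        ∎)
      where
      open ≡-Reasoning
      i<t : i < leaves t
      i<t = <ᵇ≡true⇒< e
      i<n′ : leavesL pre + i < leavesL (proj₂ (absorb x pre (nf t)))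
      i<n′ = subst (leavesL pre + i <_) (sym (leavesL-absorb-nf x pre t)) (+-monoʳ-< (leavesL pre) i<t)
    ... | false = trans (absorbAll-graftL _ _ ts (i ∸ leaves t) T wts wT (∸-<-+ (leaves t) i _ t≤i i<n))
                        (cong (λ n → acL (proj₁ q) [] (proj₂ q) n (nf T)) index)
      where
      open ≡-Reasoning
      q = absorbAll x pre (nfs (t ∷ ts))
      t≤i : leaves t ≤ i
      t≤i = <ᵇ≡false⇒≥ e
      index : leavesL (proj₂ (absorb x pre (nf t))) + (i ∸ leaves t) ≡ leavesL pre + i
      index = begin
        leavesL (proj₂ (absorb x pre (nf t))) + (i ∸ leaves t)  ≡⟨ cong (_+ (i ∸ leaves t)) (leavesL-absorb-nf x pre t) ⟩
        leavesL pre + leaves t + (i ∸ leaves t)                 ≡⟨ +-assoc (leavesL pre) (leaves t) _ ⟩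
        leavesL pre + (leaves t + (i ∸ leaves t))               ≡⟨ cong (leavesL pre +_) (m+[n∸m]≡n t≤i) ⟩
        leavesL pre + i                                         ∎

    acL-absorb-nf : ∀ x pre t i T → WF t → WF T → i < leaves t →
                    let (x′ , pre′) = absorb x pre (nf t) in
                    acL x′ [] pre′ (leavesL pre + i) (nf T) ≡ close (absorb x pre (nf (graft t i T)))
    acL-absorb-nf x pre leaf zero T _ wT _ =
      trans (acL-skip x [] pre (leaf ∷ []) 0 (nf T))
        (trans (mergeAt≡absorb x pre [] (nf T)) (cong (node _) (++-identityʳ _)))
    acL-absorb-nf x pre leaf (suc i) T _ _ (s≤s ())
    acL-absorb-nf x pre t@(node y us) i T wt wT i<n
      with acL-node (proj₁ (absorbAll y [] (nfs us))) [] (proj₂ (absorbAll y [] (nfs us))) i (nf T)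
    ... | y″ , us″ , eq , same-out =
      trans (acL-absorb-node x pre _ _ i (nf T) (subst (i <_) (sym (leaves-nf t)) i<n)
               (wf-arity (nf-WF t wt)) y″ us″ eq same-out)
            (cong (λ R → close (absorb x pre R)) (sym (trans (nf-graft t i T wt wT i<n) eq)))

  -- Grafting in F

  mutual
    graft-WF : ∀ S i T → WF S → WF T → WF (graft S i T)
    graft-WF leaf        zero    T _                 wT = wT
    graft-WF leaf        (suc i) T wS                _  = wS
    graft-WF (node x ts) i       T (wf-node h e wts) wT =
      wf-node h (trans (length-graftL ts i T) e) (graftL-WF ts i T wts wT)

    graftL-WF : ∀ ts i T → All WF ts → WF T → All WF (graftL ts i T)
    graftL-WF []       i T []         _  = []
    graftL-WF (t ∷ ts) i T (wt ∷ wts) wT with i <ᵇ leaves t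
    ... | true  = graft-WF t i T wt wT ∷ wts
    ... | false = wt ∷ graftL-WF ts _ T wts wT

    length-graftL : ∀ ts i T → length (graftL ts i T) ≡ length ts
    length-graftL []       i T = refl
    length-graftL (t ∷ ts) i T with i <ᵇ leaves t
    ... | true  = refl
    ... | false = cong suc (length-graftL ts _ T)

  mutual
    leaves-graft : ∀ S i T → i < leaves S → leaves (graft S i T) + 1 ≡ leaves S + leaves T
    leaves-graft leaf        zero    T _        = +-comm (leaves T) 1
    leaves-graft leaf        (suc i) T (s≤s ())
    leaves-graft (node x ts) i       T i<n      = leavesL-graftL ts i T i<n

    leavesL-graftL : ∀ ts i T → i < leavesL ts → leavesL (graftL ts i T) + 1 ≡ leavesL ts + leaves T
    leavesL-graftL (t ∷ ts) i T i<n with i <ᵇ leaves t in e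
    ... | true  = shuffle (leaves (graft t i T)) (leavesL ts) (leaves t) (leaves T)
                          (leaves-graft t i T (<ᵇ≡true⇒< e))
      where
      shuffle : ∀ a b c d → a + 1 ≡ c + d → a + b + 1 ≡ c + b + d
      shuffle a b c d e = begin
        a + b + 1  ≡⟨ right-comm a b 1 ⟩
        a + 1 + b  ≡⟨ cong (_+ b) e ⟩
        c + d + b  ≡⟨ right-comm c d b ⟩
        c + b + d  ∎
        where
        open ≡-Reasoning
        right-comm : ∀ m n o → m + n + o ≡ m + o + n
        right-comm = solve-∀
    ... | false = begin
      leaves t + leavesL (graftL ts (i ∸ leaves t) T) + 1    ≡⟨ +-assoc (leaves t) _ 1 ⟩
      leaves t + (leavesL (graftL ts (i ∸ leaves t) T) + 1)  ≡⟨ cong (leaves t +_) (leavesL-graftL ts _ T i∸t<n) ⟩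
      leaves t + (leavesL ts + leaves T)                     ≡⟨ sym (+-assoc (leaves t) _ _) ⟩
      leaves t + leavesL ts + leaves T                       ∎
      where
      open ≡-Reasoning
      i∸t<n = ∸-<-+ (leaves t) i (leavesL ts) (<ᵇ≡false⇒≥ e) i<n

  graftL-at : ∀ pre c rest i T → i < leaves c →
              graftL (pre ++ c ∷ rest) (leavesL pre + i) T ≡ pre ++ graft c i T ∷ rest
  graftL-at [] c rest i T i<c rewrite <⇒<ᵇ≡true i<c = refl
  graftL-at (t ∷ pre) c rest i T i<c
    rewrite +-assoc (leaves t) (leavesL pre) i
          | ≥⇒<ᵇ≡false {leaves t + (leavesL pre + i)} {leaves t} (m≤m+n _ _)
          | m+n∸m≡n (leaves t) (leavesL pre + i) = cong (t ∷_) (graftL-at pre c rest i T i<c)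

  graftL-at-leaf : ∀ pre rest T → graftL (pre ++ leaf ∷ rest) (leavesL pre) T ≡ pre ++ T ∷ rest
  graftL-at-leaf pre rest T =
    trans (cong (λ i → graftL (pre ++ leaf ∷ rest) i T) (sym (+-identityʳ (leavesL pre))))
          (graftL-at pre leaf rest 0 T (s≤s z≤n))

  graft-fits : ∀ U i w n → i + suc n ≤ leaves U → i < leaves U → i + leaves w + n ≤ leaves (graft U i w)
  graft-fits U i w n fits i<U = s≤s⁻¹ (subst₂ _≤_ (rearrange i n (leaves w))
                                               (trans (sym (leaves-graft U i w i<U)) (+-comm _ 1))
                                               (+-monoˡ-≤ (leaves w) fits))
    where
    rearrange : ∀ i n W → i + suc n + W ≡ suc (i + W + n)
    rearrange = solve-∀

  graftSeq : RTree → ℕ → List RTree → RTree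
  graftSeq U i []       = U
  graftSeq U i (w ∷ ws) = graftSeq (graft U i w) (i + leaves w) ws

  graftSeq-cong : ∀ U V i ws → U ≈F V → WF U → WF V →
                  i + length ws ≤ leaves U → i + length ws ≤ leaves V → All WF ws →
                  graftSeq U i ws ≈F graftSeq V i ws
  graftSeq-cong U V i []       U≈V _  _  _     _     _          = U≈V
  graftSeq-cong U V i (w ∷ ws) U≈V wU wV fitsU fitsV (ww ∷ wws) =
    graftSeq-cong (graft U i w) (graft V i w) (i + leaves w) ws
      (≈-cong i wU wV ww ww i<U U≈V (≈-refl ww))
      (graft-WF U i w wU ww) (graft-WF V i w wV ww)
      (graft-fits U i w (length ws) fitsU i<U) (graft-fits V i w (length ws) fitsV i<V)
      wws
    where
    i<U = m+n≤o⇒m≤o (suc i) (subst (_≤ leaves U) (+-suc i (length ws)) fitsU)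
    i<V = m+n≤o⇒m≤o (suc i) (subst (_≤ leaves V) (+-suc i (length ws)) fitsV)

  graftSeq-++ : ∀ U i xs ys → graftSeq U i (xs ++ ys) ≡ graftSeq (graftSeq U i xs) (i + leavesL xs) ys
  graftSeq-++ U i []       ys = cong (λ n → graftSeq U n ys) (sym (+-identityʳ i))
  graftSeq-++ U i (w ∷ xs) ys =
    trans (graftSeq-++ (graft U i w) (i + leaves w) xs ys)
          (cong (λ n → graftSeq (graftSeq (graft U i w) (i + leaves w) xs) n ys) (+-assoc i (leaves w) (leavesL xs)))

  graftSeq-onto-leaves : ∀ x pre post ws n → length ws ≡ n →
                         graftSeq (node x (pre ++ replicate n leaf ++ post)) (leavesL pre) ws
                           ≡ node x (pre ++ ws ++ post)
  graftSeq-onto-leaves x pre post []       zero    refl = refl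
  graftSeq-onto-leaves x pre post (w ∷ ws) (suc n) e    = begin
    graftSeq (graft (node x (pre ++ leaf ∷ replicate n leaf ++ post)) (leavesL pre) w) (leavesL pre + leaves w) ws
      ≡⟨ cong₂ (λ U i → graftSeq U i ws) graft-first (sym (leavesL-snoc pre w)) ⟩
    graftSeq (node x ((pre ++ w ∷ []) ++ replicate n leaf ++ post)) (leavesL (pre ++ w ∷ [])) ws
      ≡⟨ graftSeq-onto-leaves x (pre ++ w ∷ []) post ws n (suc-injective e) ⟩
    node x ((pre ++ w ∷ []) ++ ws ++ post)
      ≡⟨ cong (node x) (++-assoc pre (w ∷ []) _) ⟩
    node x (pre ++ w ∷ ws ++ post)
      ∎
    where
    open ≡-Reasoning
    graft-first : graft (node x (pre ++ leaf ∷ replicate n leaf ++ post)) (leavesL pre) w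
                  ≡ node x ((pre ++ w ∷ []) ++ replicate n leaf ++ post)
    graft-first = cong (node x) (trans (graftL-at-leaf pre _ w) (sym (++-assoc pre (w ∷ []) _)))

  graftSeq-onto-child-leaves : ∀ x pre post y pre₂ ws n → length ws ≡ n →
    graftSeq (node x (pre ++ node y (pre₂ ++ replicate n leaf) ∷ post)) (leavesL pre + leavesL pre₂) ws
      ≡ node x (pre ++ node y (pre₂ ++ ws) ∷ post)
  graftSeq-onto-child-leaves x pre post y pre₂ []       zero    refl = refl
  graftSeq-onto-child-leaves x pre post y pre₂ (w ∷ ws) (suc n) e    = begin
    graftSeq (graft U (leavesL pre + leavesL pre₂) w) (leavesL pre + leavesL pre₂ + leaves w) ws
      ≡⟨ cong₂ (λ U i → graftSeq U i ws) graft-first index ⟩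
    graftSeq (node x (pre ++ node y ((pre₂ ++ w ∷ []) ++ replicate n leaf) ∷ post))
             (leavesL pre + leavesL (pre₂ ++ w ∷ [])) ws
      ≡⟨ graftSeq-onto-child-leaves x pre post y (pre₂ ++ w ∷ []) ws n (suc-injective e) ⟩
    node x (pre ++ node y ((pre₂ ++ w ∷ []) ++ ws) ∷ post)
      ≡⟨ cong (λ l → node x (pre ++ node y l ∷ post)) (++-assoc pre₂ (w ∷ []) ws) ⟩
    node x (pre ++ node y (pre₂ ++ w ∷ ws) ∷ post)
      ∎
    where
    open ≡-Reasoning
    index : leavesL pre + leavesL pre₂ + leaves w ≡ leavesL pre + leavesL (pre₂ ++ w ∷ [])
    index = trans (+-assoc (leavesL pre) _ _) (cong (leavesL pre +_) (sym (leavesL-snoc pre₂ w)))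
    pre₂<y : leavesL pre₂ < leaves (node y (pre₂ ++ leaf ∷ replicate n leaf))
    pre₂<y = subst (leavesL pre₂ <_) (sym (leavesL-++ pre₂ _)) (m<m+n _ (s≤s z≤n))
    U = node x (pre ++ node y (pre₂ ++ leaf ∷ replicate n leaf) ∷ post)
    graft-first : graft U (leavesL pre + leavesL pre₂) w
                  ≡ node x (pre ++ node y ((pre₂ ++ w ∷ []) ++ replicate n leaf) ∷ post)
    graft-first = cong (node x) (trans (graftL-at pre _ post (leavesL pre₂) w pre₂<y)
                    (cong (λ l → pre ++ node y l ∷ post)
                          (trans (graftL-at-leaf pre₂ _ w) (sym (++-assoc pre₂ (w ∷ []) _)))))

  Cor-WF : ∀ x → 2 ≤ arity x → WF (Cor x)
  Cor-WF x 2≤x = wf-node 2≤x (length-replicate _) (replicate⁺ _ wf-leaf)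

  Cor-AntiC : ∀ x → AntiC (Cor x)
  Cor-AntiC x = ac-node (replicate⁺ (arity x) ac-leaf)
                        (λ j y us e → ⊥-elim (node≢leaf (!?-replicate (arity x) leaf j e)))

  graft-Cor-Cor : ∀ x y a c → arity x ≡ a + suc c →
                  graft (Cor x) a (Cor y) ≡ node x (replicate a leaf ++ Cor y ∷ replicate c leaf)
  graft-Cor-Cor x y a c e = begin
    graft (node x (replicate (arity x) leaf)) a (Cor y)
      ≡⟨ cong (λ n → graft (node x (replicate n leaf)) a (Cor y)) e ⟩
    node x (graftL (replicate (a + suc c) leaf) a (Cor y))
      ≡⟨ cong (λ l → node x (graftL l a (Cor y))) (replicate-+ a (suc c) leaf) ⟩
    node x (graftL (replicate a leaf ++ leaf ∷ replicate c leaf) a (Cor y))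
      ≡⟨ cong (λ i → node x (graftL (replicate a leaf ++ leaf ∷ replicate c leaf) i (Cor y)))
              (sym (leavesL-replicate a)) ⟩
    node x (graftL (replicate a leaf ++ leaf ∷ replicate c leaf) (leavesL (replicate a leaf)) (Cor y))
      ≡⟨ cong (node x) (graftL-at-leaf (replicate a leaf) _ (Cor y)) ⟩
    node x (replicate a leaf ++ Cor y ∷ replicate c leaf)
      ∎
    where open ≡-Reasoning

  -- Both sides are obtained from the two sides of the generator
  -- Cor x ∘ₐ Cor y ≈ Cor (x ∘ₐ y) by grafting A, B and Cs onto the leaves.
  ≈-contract : ∀ x A y B Cs p → 2 ≤ arity x → 2 ≤ arity y →
               length A + suc (length Cs) ≡ arity x → length B ≡ arity y →
               All WF A → All WF B → All WF Cs →
               node x (A ++ node y B ∷ Cs) ≈F node (comp x (length A) y p) (A ++ B ++ Cs)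
  ≈-contract x A y B Cs p 2≤x 2≤y eA eB wA wB wCs =
    subst₂ _≈F_ lhs rhs
      (graftSeq-cong U (Cor z) 0 (A ++ B ++ Cs) (≈-gen x y a p 2≤x 2≤y) wU (Cor-WF z 2≤z) fitsU fitsZ
        (++⁺ wA (++⁺ wB wCs)))
    where
    open ≡-Reasoning
    a = length A
    c = length Cs
    z = comp x a y p
    U = graft (Cor x) a (Cor y)
    2≤z : 2 ≤ arity z
    2≤z = arity-comp-≥2 x a y p 2≤x 2≤y
    wU : WF U
    wU = graft-WF (Cor x) a (Cor y) (Cor-WF x 2≤x) (Cor-WF y 2≤y)
    length-ABC : length (A ++ B ++ Cs) ≡ arity z
    length-ABC = begin
      length (A ++ B ++ Cs)   ≡⟨ trans (length-++ A) (cong (a +_) (length-++ B)) ⟩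
      a + (length B + c)      ≡⟨ sym (+-assoc a _ c) ⟩
      a + length B + c        ≡⟨ cong (λ b → a + b + c) eB ⟩
      a + arity y + c         ≡⟨ arity-comp-split x a y p a c eA ⟩
      arity z                 ∎
    leaves-U : leaves U ≡ arity z
    leaves-U = +-cancelʳ-≡ 1 (leaves U) (arity z) (begin
      leaves U + 1
        ≡⟨ leaves-graft (Cor x) a (Cor y) a<x ⟩
      leavesL (replicate (arity x) leaf) + leaves (Cor y)
        ≡⟨ cong₂ _+_ (leavesL-replicate (arity x)) (leavesL-replicate (arity y)) ⟩
      arity x + arity y
        ≡⟨ sym (arity-comp x a y p) ⟩
      arity z + 1
        ∎)
      where
      a<x : a < leaves (Cor x)
      a<x = subst (a <_) (sym (leavesL-replicate _)) (comp-index< x a y p)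
    fitsU : length (A ++ B ++ Cs) ≤ leaves U
    fitsU = ≤-reflexive (trans length-ABC (sym leaves-U))
    fitsZ : length (A ++ B ++ Cs) ≤ leaves (Cor z)
    fitsZ = ≤-reflexive (trans length-ABC (sym (leavesL-replicate _)))
    graft-A : graftSeq U 0 A ≡ node x (A ++ Cor y ∷ replicate c leaf)
    graft-A = trans (cong (λ V → graftSeq V 0 A) (graft-Cor-Cor x y a c (sym eA)))
                    (graftSeq-onto-leaves x [] (Cor y ∷ replicate c leaf) A a refl)
    graft-B : graftSeq (node x (A ++ Cor y ∷ replicate c leaf)) (leavesL A) B
              ≡ node x (A ++ node y B ∷ replicate c leaf)
    graft-B = trans (cong (λ i → graftSeq (node x (A ++ Cor y ∷ replicate c leaf)) i B) (sym (+-identityʳ _)))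
                    (graftSeq-onto-child-leaves x A (replicate c leaf) y [] B (arity y) eB)
    snoc-y : ∀ (l : List RTree) → (A ++ node y B ∷ []) ++ l ++ [] ≡ A ++ node y B ∷ l
    snoc-y l = trans (++-assoc A _ _) (cong (λ m → A ++ node y B ∷ m) (++-identityʳ l))
    graft-Cs : graftSeq (node x (A ++ node y B ∷ replicate c leaf)) (leavesL A + leavesL B) Cs
               ≡ node x (A ++ node y B ∷ Cs)
    graft-Cs = trans (cong₂ (λ V i → graftSeq V i Cs) (cong (node x) (sym (snoc-y (replicate c leaf))))
                                                       (sym (leavesL-snoc A (node y B))))
                     (trans (graftSeq-onto-leaves x (A ++ node y B ∷ []) [] Cs c refl) (cong (node x) (snoc-y Cs)))
    lhs : graftSeq U 0 (A ++ B ++ Cs) ≡ node x (A ++ node y B ∷ Cs)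
    lhs = begin
      graftSeq U 0 (A ++ B ++ Cs)
        ≡⟨ graftSeq-++ U 0 A (B ++ Cs) ⟩
      graftSeq (graftSeq U 0 A) (leavesL A) (B ++ Cs)
        ≡⟨ cong (λ V → graftSeq V (leavesL A) (B ++ Cs)) graft-A ⟩
      graftSeq (node x (A ++ Cor y ∷ replicate c leaf)) (leavesL A) (B ++ Cs)
        ≡⟨ graftSeq-++ _ (leavesL A) B Cs ⟩
      graftSeq (graftSeq (node x (A ++ Cor y ∷ replicate c leaf)) (leavesL A) B) (leavesL A + leavesL B) Cs
        ≡⟨ cong (λ V → graftSeq V (leavesL A + leavesL B) Cs) graft-B ⟩
      graftSeq (node x (A ++ node y B ∷ replicate c leaf)) (leavesL A + leavesL B) Cs
        ≡⟨ graft-Cs ⟩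
      node x (A ++ node y B ∷ Cs)                                              ∎
    rhs : graftSeq (Cor z) 0 (A ++ B ++ Cs) ≡ node z (A ++ B ++ Cs)
    rhs = trans (cong (λ l → graftSeq (node z l) 0 (A ++ B ++ Cs)) (sym (++-identityʳ _)))
                (trans (graftSeq-onto-leaves z [] [] (A ++ B ++ Cs) (arity z) length-ABC)
                       (cong (node z) (++-identityʳ _)))

  ≈-child : ∀ x pre t t′ rest → WF (node x (pre ++ leaf ∷ rest)) → WF t → WF t′ → t ≈F t′ →
            node x (pre ++ t ∷ rest) ≈F node x (pre ++ t′ ∷ rest)
  ≈-child x pre t t′ rest wS wt wt′ t≈t′ =
    subst₂ _≈F_ (cong (node x) (graftL-at-leaf pre rest t)) (cong (node x) (graftL-at-leaf pre rest t′))
      (≈-cong (leavesL pre) wS wS wt wt′ pre<n (≈-refl wS) t≈t′)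
    where
    pre<n : leavesL pre < leavesL (pre ++ leaf ∷ rest)
    pre<n = subst (leavesL pre <_) (sym (leavesL-++ pre _)) (m<m+n _ (s≤s z≤n))

  ≈-absorb : ∀ x pre c rest → 2 ≤ arity x → All WF pre → WF c → All WF rest →
             length pre + suc (length rest) ≡ arity x →
             node x (pre ++ c ∷ rest) ≈F closeWith (absorb x pre c) rest
  ≈-absorb x pre leaf rest 2≤x wpre wc wrest e =
    subst (node x (pre ++ leaf ∷ rest) ≈F_) (cong (node x) (sym (++-assoc pre _ rest)))
      (≈-refl (wf-node 2≤x (trans (length-++ pre) e) (++⁺ wpre (wc ∷ wrest))))
  ≈-absorb x pre (node y us) rest 2≤x wpre wc@(wf-node 2≤y eus wus) wrest e
    with ins x !? length pre ≟ᶜ just (out y)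
  ... | no _  =
    subst (node x (pre ++ node y us ∷ rest) ≈F_) (cong (node x) (sym (++-assoc pre _ rest)))
      (≈-refl (wf-node 2≤x (trans (length-++ pre) e) (++⁺ wpre (wc ∷ wrest))))
  ... | yes p =
    subst (node x (pre ++ node y us ∷ rest) ≈F_) (cong (node _) (sym (++-assoc pre us rest)))
      (≈-contract x pre y us rest p 2≤x 2≤y e eus wpre wus wrest)

  ≈-absorbAll : ∀ x pre rest → 2 ≤ arity x → All WF pre → All WF rest →
                length pre + length rest ≡ arity x →
                node x (pre ++ rest) ≈F close (absorbAll x pre rest)
  ≈-absorbAll x pre [] 2≤x wpre _ e =
    subst (_≈F node x pre) (cong (node x) (sym (++-identityʳ pre)))
      (≈-refl (wf-node 2≤x (trans (sym (+-identityʳ _)) e) wpre))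
  ≈-absorbAll x pre (c ∷ rest) 2≤x wpre (wc ∷ wrest) e with absorb-WF x pre c rest 2≤x wpre wc e
  ... | 2≤x′ , wpre′ , e′ =
    ≈-trans (≈-absorb x pre c rest 2≤x wpre wc wrest e) (≈-absorbAll _ _ rest 2≤x′ wpre′ wrest e′)

  mutual
    ≈-nf : ∀ t → WF t → t ≈F nf t
    ≈-nf leaf        wt                   = ≈-refl wt
    ≈-nf (node x ts) (wf-node 2≤x e wts) =
      ≈-trans (≈-nfs x [] ts 2≤x [] wts e)
              (≈-absorbAll x [] (nfs ts) 2≤x [] (nfs-WF ts wts) (trans (length-nfs ts) e))

    ≈-nfs : ∀ x pre ts → 2 ≤ arity x → All WF pre → All WF ts →
            length pre + length ts ≡ arity x →
            node x (pre ++ ts) ≈F node x (pre ++ nfs ts)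
    ≈-nfs x pre [] 2≤x wpre _ e = ≈-refl (wf-node 2≤x (trans (length-++ pre) e) (++⁺ wpre []))
    ≈-nfs x pre (t ∷ ts) 2≤x wpre (wt ∷ wts) e =
      ≈-trans (≈-child x pre t (nf t) ts (wf-node 2≤x (trans (length-++ pre) e) (++⁺ wpre (wf-leaf ∷ wts)))
                 wt (nf-WF t wt) (≈-nf t wt))
        (subst₂ _≈F_ (cong (node x) (++-assoc pre _ ts)) (cong (node x) (++-assoc pre _ (nfs ts)))
           (≈-nfs x (pre ++ nf t ∷ []) ts 2≤x (++⁺ wpre (nf-WF t wt ∷ [])) wts
                  (trans (length-snoc-+ pre (nf t) ts) e)))

  absorbAll-++ : ∀ x pre xs ys → let (x′ , pre′) = absorbAll x pre xs in
                 absorbAll x pre (xs ++ ys) ≡ absorbAll x′ pre′ ys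
  absorbAll-++ x pre []       ys = refl
  absorbAll-++ x pre (c ∷ xs) ys = absorbAll-++ _ _ xs ys

  absorb-Cor : ∀ x i y p →
               absorb x (replicate i leaf) (Cor y) ≡ (comp x i y p , replicate i leaf ++ replicate (arity y) leaf)
  absorb-Cor x i y p with ins x !? length (replicate i leaf) ≟ᶜ just (out y)
  ... | yes q = cong (_, replicate i leaf ++ replicate (arity y) leaf) (comp-cong refl (length-replicate i) refl q p)
  ... | no ¬q = ⊥-elim (¬q (trans (cong (ins x !?_) (length-replicate i)) p))

  nf-generator : ∀ x y i p → 2 ≤ arity x → 2 ≤ arity y →
                 nf (graft (Cor x) i (Cor y)) ≡ nf (Cor (comp x i y p))
  nf-generator x y i p 2≤x 2≤y with m≤n⇒∃[o]m+o≡n (comp-index< x i y p)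
  ... | c , ec = begin
    nf (graft (Cor x) i (Cor y))
      ≡⟨ cong nf (graft-Cor-Cor x y i c (sym eA)) ⟩
    close (absorbAll x [] (nfs children))
      ≡⟨ cong (λ l → close (absorbAll x [] l)) (nfs-anticoloured children wchildren achildren) ⟩
    close (absorbAll x [] (replicate i leaf ++ Cor y ∷ replicate c leaf))
      ≡⟨ cong close (absorbAll-++ x [] (replicate i leaf) (Cor y ∷ replicate c leaf)) ⟩
    close (absorbAll _ _ (Cor y ∷ replicate c leaf))
      ≡⟨ cong (λ q → close (absorbAll (proj₁ q) (proj₂ q) (Cor y ∷ replicate c leaf)))
              (absorbAll-leaves x [] i) ⟩
    close (absorbAll _ _ (replicate c leaf))
      ≡⟨ cong (λ q → close (absorbAll (proj₁ q) (proj₂ q) (replicate c leaf))) (absorb-Cor x i y p) ⟩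
    close (absorbAll z (replicate i leaf ++ replicate (arity y) leaf) (replicate c leaf))
      ≡⟨ cong close (absorbAll-leaves z _ c) ⟩
    node z ((replicate i leaf ++ replicate (arity y) leaf) ++ replicate c leaf)
      ≡⟨ cong (node z) all-leaves ⟩
    Cor z
      ≡⟨ sym (nf-anticoloured (Cor z) (Cor-WF z (arity-comp-≥2 x i y p 2≤x 2≤y)) (Cor-AntiC z)) ⟩
    nf (Cor z)
      ∎
    where
    open ≡-Reasoning
    z = comp x i y p
    eA : i + suc c ≡ arity x
    eA = trans (+-suc i c) ec
    children = replicate i leaf ++ Cor y ∷ replicate c leaf
    wchildren : All WF children
    wchildren = ++⁺ (replicate⁺ i wf-leaf) (Cor-WF y 2≤y ∷ replicate⁺ c wf-leaf)
    achildren : All AntiC children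
    achildren = ++⁺ (replicate⁺ i ac-leaf) (Cor-AntiC y ∷ replicate⁺ c ac-leaf)
    all-leaves : (replicate i leaf ++ replicate (arity y) leaf) ++ replicate c leaf ≡ replicate (arity z) leaf
    all-leaves = begin
      (replicate i leaf ++ replicate (arity y) leaf) ++ replicate c leaf
        ≡⟨ cong (_++ replicate c leaf) (sym (replicate-+ i _ leaf)) ⟩
      replicate (i + arity y) leaf ++ replicate c leaf
        ≡⟨ sym (replicate-+ (i + arity y) c leaf) ⟩
      replicate (i + arity y + c) leaf
        ≡⟨ cong (λ n → replicate n leaf) (arity-comp-split x i y p i c eA) ⟩
      replicate (arity z) leaf
        ∎

  nf-resp-≈ : ∀ {S T} → S ≈F T → nf S ≡ nf T
  nf-resp-≈ (≈-gen x y i p 2≤x 2≤y) = nf-generator x y i p 2≤x 2≤y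
  nf-resp-≈ (≈-refl _)              = refl
  nf-resp-≈ (≈-sym S≈T)             = sym (nf-resp-≈ S≈T)
  nf-resp-≈ (≈-trans S≈T T≈U)       = trans (nf-resp-≈ S≈T) (nf-resp-≈ T≈U)
  nf-resp-≈ (≈-cong {S} {S′} {T} {T′} i wS wS′ wT wT′ i<S S≈S′ T≈T′) = begin
    nf (graft S i T)            ≡⟨ nf-graft S i T wS wT i<S ⟩
    acComp (nf S) i (nf T)      ≡⟨ cong₂ (λ A B → acComp A i B) (nf-resp-≈ S≈S′) (nf-resp-≈ T≈T′) ⟩
    acComp (nf S′) i (nf T′)    ≡⟨ sym (nf-graft S′ i T′ wS′ wT′ i<S′) ⟩
    nf (graft S′ i T′)          ∎
    where
    open ≡-Reasoning
    i<S′ : i < leaves S′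
    i<S′ = subst (i <_) (trans (sym (leaves-nf S)) (trans (cong leaves (nf-resp-≈ S≈S′)) (leaves-nf S′))) i<S

  nf≡⇒≈ : ∀ {S T} → WF S → WF T → nf S ≡ nf T → S ≈F T
  nf≡⇒≈ {S} {T} wS wT nfS≡nfT =
    ≈-trans (≈-nf S wS) (subst (_≈F T) (sym nfS≡nfT) (≈-sym (≈-nf T wT)))

mainTheorem2 : ∀ {k : ℕ} (C : ColOperad k) → let open Trees C in
    Σ (RTree → RTree) λ φ →
      (∀ T → WF T → WF (φ T) × AntiC (φ T))
      × (∀ T → WF T → leaves (φ T) ≡ leaves T)
      × (φ leaf ≡ leaf)
      × (∀ S i T → WF S → WF T → i < leaves S →
           φ (graft S i T) ≡ acComp (φ S) i (φ T))
      × (∀ S T → WF S → WF T → (S ≈F T → φ S ≡ φ T) × (φ S ≡ φ T → S ≈F T))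
      × (∀ A → WF A → AntiC A → Σ RTree λ T → WF T × φ T ≡ A)
mainTheorem2 C =
  nf ,
  (λ T wT → nf-WF T wT , nf-AntiC T wT) ,
  (λ T _ → leaves-nf T) ,
  refl ,
  nf-graft ,
  (λ S T wS wT → nf-resp-≈ , nf≡⇒≈ wS wT) ,
  (λ A wA aA → A , wA , nf-anticoloured A wA aA)
  where
  open Trees C
  open NormalForm C
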